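{- Let $P$ be a finite poset and let $A$ be an antichain of $P$ containing no pair $u,v \in A$ with $u \prec v$. Then the distributive lattice $J(P)$ has the Boolean algebra decomposition $$J(P) = \bigcup_{I \in J''(P)} [I, \psi(I)],$$ that is, $J(P)$ is the union of the intervals $[I,\psi(I)]$ for $I \in J''(P)$, these intervals are pairwise disjoint, and each is isomorphic to a Boolean algebra.
   Context: $J(P)$ denotes the set of lower order ideals (down-sets) of $P$, ordered by inclusion; intervals $[I,I']$ are taken in $J(P)$. $J''(P)$ is the set of $I \in J(P)$ having no maximal element (maximal within $I$) lying in $A$. For $I \in J(P)$, $\psi(I) = I \cup \{a \in A : I \cup \{a\} \in J(P)\}$. -}

module Defs where

open import Level using (0ℓ)
open import Data.Nat using (ℕ)
open import Data.Fin using (Fin)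
open import Data.Fin.Subset using (Subset; _∈_; _∉_; _⊆_; _∪_; ⁅_⁆)
open import Data.Fin.Subset.Properties using (_∈?_)
open import Data.Fin.Properties using (all?)
open import Data.Bool using (_∨_; _∧_)
open import Data.Vec using (tabulate)
open import Data.Product using (Σ; ∃; _×_; _,_)
open import Relation.Binary using (Rel; IsDecPartialOrder)
open import Relation.Binary.PropositionalEquality using (_≡_)
open import Relation.Nullary using (Dec; yes; no; does; ¬_)
open import Relation.Nullary.Decidable using (_→-dec_)

record FinPoset : Set₁ where
  field
    n     : ℕ
    _≤_   : Rel (Fin n) 0ℓ
    isDPO : IsDecPartialOrder _≡_ _≤_
  open IsDecPartialOrder isDPO public using (_≤?_)

  _<_ : Fin n → Fin n → Set
  x < y = x ≤ y × ¬ (x ≡ y)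

  _⋖_ : Fin n → Fin n → Set
  u ⋖ v = u < v × (∀ w → u < w → ¬ (w < v))

module _ (P : FinPoset) where
  open FinPoset P

  IsIdeal : Subset n → Set
  IsIdeal I = ∀ x y → y ≤ x → x ∈ I → y ∈ I

  isIdeal? : (I : Subset n) → Dec (IsIdeal I)
  isIdeal? I = all? λ x → all? λ y → (y ≤? x) →-dec ((x ∈? I) →-dec (y ∈? I))

  IsAntichain : Subset n → Set
  IsAntichain A = ∀ u v → u ∈ A → v ∈ A → u ≤ v → u ≡ v

  NoCoverIn : Subset n → Set
  NoCoverIn A = ∀ u v → u ∈ A → v ∈ A → ¬ (u ⋖ v)

  IsMaximalIn : Fin n → Subset n → Set
  IsMaximalIn x I = x ∈ I × (∀ y → y ∈ I → x ≤ y → y ≡ x)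

  InJ'' : Subset n → Subset n → Set
  InJ'' A I = IsIdeal I × (∀ x → x ∈ A → ¬ IsMaximalIn x I)

  ψ : Subset n → Subset n → Subset n
  ψ A I = tabulate λ a → does (a ∈? I) ∨ (does (a ∈? A) ∧ does (isIdeal? (I ∪ ⁅ a ⁆)))

  InInterval : Subset n → Subset n → Subset n → Set
  InInterval I I' K = IsIdeal K × I ⊆ K × K ⊆ I'

  Interval : Subset n → Subset n → Set
  Interval I I' = Σ (Subset n) (InInterval I I')

elt : ∀ {P : FinPoset} {I I'} → Interval P I I' → Subset (FinPoset.n P)
elt (K , _) = K

-- The interval [I, I'] (ordered by inclusion) is isomorphic to a Boolean
-- algebra: a surjective order embedding onto the power set (Subset k, ⊆)
-- of a k-element set, for some k.
IsBooleanInterval : (P : FinPoset) → Subset (FinPoset.n P) → Subset (FinPoset.n P) → Set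
IsBooleanInterval P I I' =
  ∃ λ (k : ℕ) → Σ (Interval P I I' → Subset k) λ f →
      (∀ K L → (elt {P} K ⊆ elt {P} L → f K ⊆ f L) × (f K ⊆ f L → elt {P} K ⊆ elt {P} L))
    × (∀ s → ∃ λ K → f K ≡ s)

module Submission where

-- For an ideal K let  core K  be K with its maximal elements lying in A
-- removed.  Since A is an antichain, core K is again an ideal, it has no
-- maximal element in A (so core K ∈ J''), and every removed element can be
-- re-adjoined to it, so K ∈ [core K, ψ(core K)]: this is the covering part.
-- Conversely, if K ∈ [I', ψ(I')] then every element of K outside I' is a
-- maximal element of K lying in A; hence any I ∈ J'' below K lies inside I',
-- and two admissible I, I' contain each other: this is disjointness.
-- Finally every set between an ideal I and ψ(I) is an ideal, so [I, ψ(I)]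
-- is the full power set of the support  ψ(I) ∖ I,  and restricting to that
-- support is the required isomorphism with a Boolean algebra.

open import Defs
open import Data.Fin.Subset using (Subset)
open import Data.Product using (∃; _×_)
open import Relation.Binary.PropositionalEquality using (_≡_)

open import Data.Nat using (ℕ; zero; suc)
open import Data.Fin using (Fin)
open import Data.Fin.Properties using (all?) renaming (_≟_ to _≟ᶠ_)
open import Data.Fin.Subset using (_∈_; _∉_; _⊆_; _∪_; ⁅_⁆)
open import Data.Fin.Subset.Properties
  using (_∈?_; x∈p∪q⁻; x∈p∪q⁺; p⊆p∪q; x∈⁅x⁆; x∈⁅y⁆⇒x≡y; ⊆-antisym; drop-there)
open import Data.Bool using (true; false)
open import Data.Vec using ([]; _∷_; tabulate; here; there)
open import Data.Vec.Properties using ([]=⇒lookup; lookup⇒[]=; lookup∘tabulate)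
open import Data.Product using (_,_; proj₁; proj₂)
open import Data.Sum using (_⊎_; inj₁; inj₂)
open import Data.Empty using (⊥-elim)
open import Relation.Binary.PropositionalEquality using (refl; sym; trans; subst; cong)
open import Relation.Nullary using (Dec; yes; no; does; ¬_; ¬?)
open import Relation.Nullary.Decidable using (_×-dec_; _⊎-dec_; _→-dec_)

private
  variable
    m : ℕ

⟦_⟧ : {Q : Fin m → Set} → (∀ x → Dec (Q x)) → Subset m
⟦ Q? ⟧ = tabulate (λ x → does (Q? x))

∈⟦⟧⁺ : {Q : Fin m → Set} (Q? : ∀ x → Dec (Q x)) {x : Fin m} → Q x → x ∈ ⟦ Q? ⟧
∈⟦⟧⁺ Q? {x} q with Q? x in eq
... | yes _ = lookup⇒[]= x _ (trans (lookup∘tabulate (λ y → does (Q? y)) x) (cong does eq))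
... | no ¬q = ⊥-elim (¬q q)

∈⟦⟧⁻ : {Q : Fin m → Set} (Q? : ∀ x → Dec (Q x)) {x : Fin m} → x ∈ ⟦ Q? ⟧ → Q x
∈⟦⟧⁻ Q? {x} x∈ with Q? x in eq
... | yes q = q
... | no _ with trans (sym ([]=⇒lookup x∈)) (trans (lookup∘tabulate (λ y → does (Q? y)) x) (cong does eq))
... | ()

-- The power set of a support D ⊆ Fin m, encoded as Subset (dim D).

dim : Subset m → ℕ
dim []            = zero
dim (true  ∷ D) = suc (dim D)
dim (false ∷ D) = dim D

restrict : (D : Subset m) → Subset m → Subset (dim D)
restrict []            []       = []
restrict (true  ∷ D) (x ∷ X) = x ∷ restrict D X
restrict (false ∷ D) (_ ∷ X) = restrict D X

extend : (D : Subset m) → Subset (dim D) → Subset m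
extend []            []       = []
extend (true  ∷ D) (y ∷ s) = y ∷ extend D s
extend (false ∷ D) s       = false ∷ extend D s

⊆-tail : ∀ {x y} {X Y : Subset m} → (x ∷ X) ⊆ (y ∷ Y) → X ⊆ Y
⊆-tail X⊆Y p = drop-there (X⊆Y (there p))

restrict-mono : (D X Y : Subset m) → X ⊆ Y → restrict D X ⊆ restrict D Y
restrict-mono (true  ∷ D) (x ∷ X) (y ∷ Y) X⊆Y here with X⊆Y here
... | here = here
restrict-mono (true  ∷ D) (x ∷ X) (y ∷ Y) X⊆Y (there p) =
  there (restrict-mono D X Y (⊆-tail X⊆Y) p)
restrict-mono (false ∷ D) (x ∷ X) (y ∷ Y) X⊆Y p = restrict-mono D X Y (⊆-tail X⊆Y) p

restrict-reflects : (D X Y : Subset m) → restrict D X ⊆ restrict D Y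
  → ∀ {i} → i ∈ D → i ∈ X → i ∈ Y
restrict-reflects (true ∷ D) (true ∷ X) (y ∷ Y) sub here here with sub here
... | here = here
restrict-reflects (true  ∷ D) (x ∷ X) (y ∷ Y) sub (there i∈D) (there i∈X) =
  there (restrict-reflects D X Y (⊆-tail sub) i∈D i∈X)
restrict-reflects (false ∷ D) (x ∷ X) (y ∷ Y) sub (there i∈D) (there i∈X) =
  there (restrict-reflects D X Y sub i∈D i∈X)

extend-⊆ : (D : Subset m) (s : Subset (dim D)) → extend D s ⊆ D
extend-⊆ (true  ∷ D) (y ∷ s) here      = here
extend-⊆ (true  ∷ D) (y ∷ s) (there p) = there (extend-⊆ D s p)
extend-⊆ (false ∷ D) s       (there p) = there (extend-⊆ D s p)

restrict-extend : (D X : Subset m) (s : Subset (dim D))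
  → (∀ {i} → i ∈ X → i ∉ D) → restrict D (X ∪ extend D s) ≡ s
restrict-extend []            []           []       _ = refl
restrict-extend (true  ∷ D) (true  ∷ X) (y ∷ s) disj = ⊥-elim (disj here here)
restrict-extend (true  ∷ D) (false ∷ X) (y ∷ s) disj =
  cong (y ∷_) (restrict-extend D X s (λ p d → disj (there p) (there d)))
restrict-extend (false ∷ D) (x ∷ X)     s       disj =
  restrict-extend D X s (λ p d → disj (there p) (there d))

module Decomposition (P : FinPoset) (A : Subset (FinPoset.n P))
                     (antichain : IsAntichain P A) where
  open FinPoset P

  Addable : Subset n → Fin n → Set
  Addable I a = a ∈ A × IsIdeal P (I ∪ ⁅ a ⁆)

  -- The decision procedure underlying ψ: ψ P A I is ⟦ ψ? I ⟧ by definition.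
  ψ? : (I : Subset n) → ∀ a → Dec (a ∈ I ⊎ Addable I a)
  ψ? I a = (a ∈? I) ⊎-dec ((a ∈? A) ×-dec isIdeal? P (I ∪ ⁅ a ⁆))

  ∈ψ⁻ : ∀ I {a} → a ∈ ψ P A I → a ∈ I ⊎ Addable I a
  ∈ψ⁻ I = ∈⟦⟧⁻ (ψ? I)

  ∈ψ⁺ : ∀ I {a} → a ∈ I ⊎ Addable I a → a ∈ ψ P A I
  ∈ψ⁺ I = ∈⟦⟧⁺ (ψ? I)

  between-ideal : ∀ {I K} → IsIdeal P I → I ⊆ K → K ⊆ ψ P A I → IsIdeal P K
  between-ideal {I} {K} I-ideal I⊆K K⊆ψI x y y≤x x∈K with ∈ψ⁻ I (K⊆ψI x∈K)
  ... | inj₁ x∈I = I⊆K (I-ideal x y y≤x x∈I)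
  ... | inj₂ (_ , I+x-ideal) with x∈p∪q⁻ I ⁅ x ⁆ (I+x-ideal x y y≤x (x∈p∪q⁺ (inj₂ (x∈⁅x⁆ x))))
  ...   | inj₁ y∈I = I⊆K y∈I
  ...   | inj₂ y∈⁅x⁆ = subst (_∈ K) (sym (x∈⁅y⁆⇒x≡y x y∈⁅x⁆)) x∈K

  Removable : Subset n → Fin n → Set
  Removable K x = x ∈ A × IsMaximalIn P x K

  removable? : ∀ K x → Dec (Removable K x)
  removable? K x = (x ∈? A) ×-dec ((x ∈? K) ×-dec
    all? (λ y → (y ∈? K) →-dec ((x ≤? y) →-dec (y ≟ᶠ x))))

  new-removable : ∀ {I' K x} → IsIdeal P I' → K ⊆ ψ P A I'
    → x ∈ K → x ∉ I' → Removable K x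
  new-removable {I'} {K} {x} I'-ideal K⊆ψI' x∈K x∉I' = x∈A , x∈K , maximal
    where
    ∈A-outside : ∀ {y} → y ∈ K → y ∉ I' → y ∈ A
    ∈A-outside y∈K y∉I' with ∈ψ⁻ I' (K⊆ψI' y∈K)
    ... | inj₁ y∈I'      = ⊥-elim (y∉I' y∈I')
    ... | inj₂ (y∈A , _) = y∈A

    x∈A : x ∈ A
    x∈A = ∈A-outside x∈K x∉I'

    -- y ≥ x is not in I' (I' is a down-set), so y ∈ A and y = x.
    maximal : ∀ y → y ∈ K → x ≤ y → y ≡ x
    maximal y y∈K x≤y =
      sym (antichain x y x∈A (∈A-outside y∈K (λ y∈I' → x∉I' (I'-ideal y x x≤y y∈I'))) x≤y)

  J''-below : ∀ {I I' K} → InJ'' P A I → I ⊆ K → IsIdeal P I' → K ⊆ ψ P A I' → I ⊆ I'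
  J''-below {I} {I'} (_ , no-max) I⊆K I'-ideal K⊆ψI' {x} x∈I with x ∈? I'
  ... | yes x∈I' = x∈I'
  ... | no  x∉I' with new-removable I'-ideal K⊆ψI' (I⊆K x∈I) x∉I'
  ...   | x∈A , _ , max-in-K = ⊥-elim (no-max x x∈A (x∈I , λ y y∈I → max-in-K y (I⊆K y∈I)))

  module Core (K : Subset n) (K-ideal : IsIdeal P K) where
    core? : ∀ x → Dec (x ∈ K × ¬ Removable K x)
    core? x = (x ∈? K) ×-dec ¬? (removable? K x)

    core : Subset n
    core = ⟦ core? ⟧

    core⊆K : core ⊆ K
    core⊆K x∈ = proj₁ (∈⟦⟧⁻ core? x∈)

    -- Below a non-removable element there are only non-removable ones:
    -- a removable y ≤ x ∈ K forces x = y.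
    core-ideal : IsIdeal P core
    core-ideal x y y≤x x∈core with ∈⟦⟧⁻ core? x∈core
    ... | x∈K , x-kept = ∈⟦⟧⁺ core? (K-ideal x y y≤x x∈K , y-kept)
      where
      y-kept : ¬ Removable K y
      y-kept (y∈A , y∈K , y-max) =
        x-kept (subst (Removable K) (sym (y-max x x∈K y≤x)) (y∈A , y∈K , y-max))

    -- A maximal element of core K lying in A would be removable in K:
    -- above it in K there are only core elements and (by the antichain
    -- property) nothing else of A.
    core-J'' : InJ'' P A core
    core-J'' = core-ideal , no-max
      where
      no-max : ∀ a → a ∈ A → ¬ IsMaximalIn P a core
      no-max a a∈A (a∈core , a-max) = proj₂ (∈⟦⟧⁻ core? a∈core) (a∈A , core⊆K a∈core , max-in-K)
        where
        max-in-K : ∀ y → y ∈ K → a ≤ y → y ≡ a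
        max-in-K y y∈K a≤y with removable? K y
        ... | yes (y∈A , _) = sym (antichain a y a∈A y∈A a≤y)
        ... | no  y-kept    = a-max y (∈⟦⟧⁺ core? (y∈K , y-kept)) a≤y

    removable-addable : ∀ {x} → x ∈ K → Removable K x → Addable core x
    removable-addable {x} x∈K (x∈A , _) = x∈A , ideal
      where
      ideal : IsIdeal P (core ∪ ⁅ x ⁆)
      ideal w z z≤w w∈ with x∈p∪q⁻ core ⁅ x ⁆ w∈
      ... | inj₁ w∈core = x∈p∪q⁺ (inj₁ (core-ideal w z z≤w w∈core))
      ... | inj₂ w∈⁅x⁆ with z ≟ᶠ x
      ...   | yes refl = x∈p∪q⁺ (inj₂ (x∈⁅x⁆ x))
      ...   | no  z≢x  = x∈p∪q⁺ (inj₁ (∈⟦⟧⁺ core? (K-ideal x z z≤x x∈K , z-kept)))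
        where
        z≤x : z ≤ x
        z≤x = subst (z ≤_) (x∈⁅y⁆⇒x≡y x w∈⁅x⁆) z≤w

        z-kept : ¬ Removable K z
        z-kept (z∈A , _) = z≢x (antichain z x z∈A x∈A z≤x)

    K⊆ψcore : K ⊆ ψ P A core
    K⊆ψcore {x} x∈K with removable? K x
    ... | yes x-rem  = ∈ψ⁺ core (inj₂ (removable-addable x∈K x-rem))
    ... | no  x-kept = ∈ψ⁺ core (inj₁ (∈⟦⟧⁺ core? (x∈K , x-kept)))

    covered : InJ'' P A core × InInterval P core (ψ P A core) K
    covered = core-J'' , K-ideal , core⊆K , K⊆ψcore

  module Boolean (I : Subset n) (I-ideal : IsIdeal P I) where
    support? : ∀ x → Dec (x ∈ ψ P A I × x ∉ I)
    support? x = (x ∈? ψ P A I) ×-dec ¬? (x ∈? I)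

    support : Subset n
    support = ⟦ support? ⟧

    coordinates : Interval P I (ψ P A I) → Subset (dim support)
    coordinates (K , _) = restrict support K

    reflects : ∀ (K L : Interval P I (ψ P A I))
      → coordinates K ⊆ coordinates L → elt {P} K ⊆ elt {P} L
    reflects (K , _ , _ , K⊆ψI) (L , _ , I⊆L , _) sub {x} x∈K with x ∈? I
    ... | yes x∈I = I⊆L x∈I
    ... | no  x∉I = restrict-reflects support K L sub (∈⟦⟧⁺ support? (K⊆ψI x∈K , x∉I)) x∈K

    lift : (s : Subset (dim support)) → Interval P I (ψ P A I)
    lift s = I ∪ extend support s , between-ideal I-ideal I⊆ ⊆ψI , I⊆ , ⊆ψI
      where
      I⊆ : I ⊆ I ∪ extend support s
      I⊆ = p⊆p∪q (extend support s)

      ⊆ψI : I ∪ extend support s ⊆ ψ P A I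
      ⊆ψI x∈ with x∈p∪q⁻ I (extend support s) x∈
      ... | inj₁ x∈I = ∈ψ⁺ I (inj₁ x∈I)
      ... | inj₂ x∈s = proj₁ (∈⟦⟧⁻ support? (extend-⊆ support s x∈s))

    boolean : IsBooleanInterval P I (ψ P A I)
    boolean = dim support , coordinates ,
      (λ K L → restrict-mono support (elt {P} K) (elt {P} L) , reflects K L) ,
      (λ s → lift s , restrict-extend support I s (λ x∈I x∈D → proj₂ (∈⟦⟧⁻ support? x∈D) x∈I))

-- Theorem 4.1.

theorem4p1 : (P : FinPoset) (A : Subset (FinPoset.n P))
    → IsAntichain P A
    → NoCoverIn P A
    → (∀ K → IsIdeal P K → ∃ λ I → InJ'' P A I × InInterval P I (ψ P A I) K)
    × (∀ I I' K → InJ'' P A I → InJ'' P A I' → InInterval P I (ψ P A I) K → InInterval P I' (ψ P A I') K → I ≡ I')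
    × (∀ I → InJ'' P A I → IsBooleanInterval P I (ψ P A I))
theorem4p1 P A antichain _ = covering , disjoint , boolean
  where
  open Decomposition P A antichain

  covering : ∀ K → IsIdeal P K → ∃ λ I → InJ'' P A I × InInterval P I (ψ P A I) K
  covering K K-ideal = Core.core K K-ideal , Core.covered K K-ideal

  disjoint : ∀ I I' K → InJ'' P A I → InJ'' P A I'
    → InInterval P I (ψ P A I) K → InInterval P I' (ψ P A I') K → I ≡ I'
  disjoint I I' K I∈J'' I'∈J'' (_ , I⊆K , K⊆ψI) (_ , I'⊆K , K⊆ψI') =
    ⊆-antisym (J''-below I∈J'' I⊆K (proj₁ I'∈J'') K⊆ψI')
              (J''-below I'∈J'' I'⊆K (proj₁ I∈J'') K⊆ψI)

  boolean : ∀ I → InJ'' P A I → IsBooleanInterval P I (ψ P A I)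
  boolean I (I-ideal , _) = Boolean.boolean I I-ideal
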